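{- Let $G$ be a finite bipartite graph with color classes $A$ and $B$, and $b:V(G)\to\mathbb{Z}_{\ge0}$. Let $C_1,C_2$ be consistent flexible components, and let $D_1,\dots,D_k$ ($k\ge1$) be consistent flexible components with $D_1=C_1$, $D_k=C_2$, and $D_i\preceq^\circ_A D_{i+1}$ for all $i<k$ (so $C_1\le_A C_2$). Let $A_i:=V(C_i)\cap A$ and $B_i:=V(C_i)\cap B$ for $i=1,2$. Then for every maximum $b$-matching $M$ of $G$: (i) for any $x\in A_1$, $y\in A_2$ there is an $M$-wedge path from $x$ to $y$; (ii) for any $x\in A_1$, $y\in B_2$ there is an $M$-saturated path between $x$ and $y$; (iii) for any $x\in A_2$, $y\in B_1$ there is an $M$-exposed path between $x$ and $y$; (iv) for any $x\in B_1$, $y\in B_2$ there is an $M$-wedge path from $y$ to $x$. Moreover, these paths can be chosen with all vertices in $V(D_1)\cup\dots\cup V(D_k)$.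
   Context: $\delta_H(v)$: edges of graph $H$ at $v$. A $b$-matching is $M\subseteq E(G)$ with at most $b(v)$ edges of $M$ at each $v$; maximum = largest cardinality; $v$ is $M$-loose if fewer than $b(v)$ edges of $M$ are incident with it. An edge is allowed if in some maximum $b$-matching, forbidden otherwise; an allowed edge is inevitable if in every maximum $b$-matching, flexible otherwise. Flexible components: induced subgraphs $G[V(K)]$, $K$ a connected component of $(V(G),\{\text{flexible edges}\})$. $\mathcal{D}$: vertices $M$-loose for some maximum $b$-matching $M$. A flexible component $C$ is consistent unless it meets $\mathcal{D}$ or it is $G[\{v\}]$ with $b(v)=0$ and $v$ having a neighbor in $\mathcal{D}$. For flexible components $C,C'$, $C\preceq^\circ_A C'$ if $C=C'$, or an inevitable edge joins $V(C)\cap A$ to $V(C')\cap B$, or a forbidden edge joins $V(C')\cap A$ to $V(C)\cap B$. Paths are subgraphs. A path $P$ with ends $x,y$ is $M$-wedge from $x$ to $y$ if $|\delta_P(v)\cap M|=1$ for $v\in V(P)\setminus\{y\}$ and $\delta_P(y)\cap M=\emptyset$; $M$-saturated between $x,y$ if $|\delta_P(v)\cap M|=1$ for all $v\in V(P)$; $M$-exposed between $x,y$ if $|\delta_P(v)\setminus M|=1$ for all $v\in V(P)$. -}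

module Defs where

open import Data.Nat using (ℕ; zero; suc; _≤_; _<_)
open import Data.Bool using (Bool; true; false; _∧_; _∨_; not)
open import Data.Fin using (Fin; zero; suc; inject₁; fromℕ; _≟_)
open import Data.Fin.Subset using (Subset; _∈_; _∉_; ∣_∣)
open import Data.Fin.Subset.Properties using (_∈?_)
open import Data.Vec using (tabulate)
open import Data.Product using (Σ; _×_; _,_; ∃; ∃-syntax)
open import Data.Sum using (_⊎_)
open import Relation.Nullary using (¬_)
open import Relation.Nullary.Decidable using (⌊_⌋)
open import Relation.Binary.PropositionalEquality using (_≡_; _≢_)
open import Relation.Binary.Construct.Closure.ReflexiveTransitive using (Star)
open import Function.Definitions using (Injective)

record BGraph : Set where
  field
    n      : ℕ
    m      : ℕ
    inA    : Fin n → Bool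
    tl     : Fin m → Fin n
    hd     : Fin m → Fin n
    tl∈A   : ∀ e → inA (tl e) ≡ true
    hd∈B   : ∀ e → inA (hd e) ≡ false
    simple : ∀ e e′ → tl e ≡ tl e′ → hd e ≡ hd e′ → e ≡ e′

module _ (G : BGraph) where
  open BGraph G

  InA InB : Fin n → Set
  InA v = inA v ≡ true
  InB v = inA v ≡ false

  Joins : Fin m → Fin n → Fin n → Set
  Joins e u v = (tl e ≡ u × hd e ≡ v) ⊎ (tl e ≡ v × hd e ≡ u)

  Adjacent : Fin n → Fin n → Set
  Adjacent u v = ∃[ e ] Joins e u v

  incident : Fin n → Subset m
  incident v = tabulate (λ e → ⌊ tl e ≟ v ⌋ ∨ ⌊ hd e ≟ v ⌋)

  degM : Subset m → Fin n → ℕ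
  degM M v = ∣ tabulate (λ e → (⌊ tl e ≟ v ⌋ ∨ ⌊ hd e ≟ v ⌋) ∧ ⌊ e ∈? M ⌋) ∣

  module _ (b : Fin n → ℕ) where

    IsBMatching : Subset m → Set
    IsBMatching M = ∀ v → degM M v ≤ b v

    IsMaxBMatching : Subset m → Set
    IsMaxBMatching M = IsBMatching M × (∀ M′ → IsBMatching M′ → ∣ M′ ∣ ≤ ∣ M ∣)

    Loose : Subset m → Fin n → Set
    Loose M v = degM M v < b v

    Allowed : Fin m → Set
    Allowed e = ∃[ M ] (IsMaxBMatching M × e ∈ M)

    Forbidden : Fin m → Set
    Forbidden e = ¬ Allowed e

    Inevitable : Fin m → Set
    Inevitable e = Allowed e × (∀ M → IsMaxBMatching M → e ∈ M)

    Flexible : Fin m → Set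
    Flexible e = Allowed e × ¬ Inevitable e

    InD : Fin n → Set
    InD v = ∃[ M ] (IsMaxBMatching M × Loose M v)

    FlexStep : Fin n → Fin n → Set
    FlexStep u v = ∃[ e ] (Flexible e × Joins e u v)

    -- A flexible component is represented by any of its vertices r:
    -- V(C_r) = vertices reachable from r via flexible edges.
    InComp : Fin n → Fin n → Set
    InComp r v = Star FlexStep r v

    SameComp : Fin n → Fin n → Set
    SameComp r r′ = InComp r r′

    Inconsistent : Fin n → Set
    Inconsistent r =
      (∃[ v ] (InComp r v × InD v))
      ⊎ ((∀ w → InComp r w → w ≡ r) × b r ≡ 0 × (∃[ u ] (Adjacent r u × InD u)))

    Consistent : Fin n → Set
    Consistent r = ¬ Inconsistent r

    PrecA : Fin n → Fin n → Set
    PrecA r r′ =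
      SameComp r r′
      ⊎ (∃[ e ] (Inevitable e × InComp r (tl e) × InComp r′ (hd e)))
      ⊎ (∃[ e ] (Forbidden e × InComp r′ (tl e) × InComp r (hd e)))

  record Path : Set where
    field
      len    : ℕ
      vs     : Fin (suc len) → Fin n
      vs-inj : Injective _≡_ _≡_ vs
      es     : Fin len → Fin m
      joins  : ∀ i → Joins (es i) (vs (inject₁ i)) (vs (suc i))

    start end : Fin n
    start = vs zero
    end   = vs (fromℕ len)

    OnPath : Fin n → Set
    OnPath v = ∃[ j ] vs j ≡ v

    degPM : Subset m → Fin n → ℕ
    degPM M v = ∣ tabulate (λ i → ⌊ es i ∈? M ⌋ ∧ (⌊ vs (inject₁ i) ≟ v ⌋ ∨ ⌊ vs (suc i) ≟ v ⌋)) ∣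

    degPnotM : Subset m → Fin n → ℕ
    degPnotM M v = ∣ tabulate (λ i → not ⌊ es i ∈? M ⌋ ∧ (⌊ vs (inject₁ i) ≟ v ⌋ ∨ ⌊ vs (suc i) ≟ v ⌋)) ∣

  open Path

  HasEnds : Path → Fin n → Fin n → Set
  HasEnds P x y = start P ≡ x × end P ≡ y

  Wedge : Subset m → Path → Fin n → Fin n → Set
  Wedge M P x y = HasEnds P x y
    × (∀ v → OnPath P v → v ≢ y → degPM P M v ≡ 1)
    × degPM P M y ≡ 0

  Saturated : Subset m → Path → Fin n → Fin n → Set
  Saturated M P x y = HasEnds P x y × (∀ v → OnPath P v → degPM P M v ≡ 1)

  Exposed : Subset m → Path → Fin n → Fin n → Set
  Exposed M P x y = HasEnds P x y × (∀ v → OnPath P v → degPnotM P M v ≡ 1)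

  OnP : Path → Fin n → Set
  OnP P v = OnPath P v

-- Orient each edge from A to B if it lies in M and from B to A otherwise. A flexible edge f lies
-- in M Δ M′ for a second maximum matching M′. On a consistent component no vertex is ever loose,
-- so M Δ M′ is balanced there, and double counting over the set reachable from the head of f shows
-- that this set contains the tail of f: f lies on a directed cycle inside its component. Hence
-- consistent flexible components are strongly connected, and for D i ⪯°_A D (i+1) the inevitable
-- edge (which is in M) or the forbidden edge (which is not) is an arc from D i to D (i+1). So every
-- vertex of C₁ reaches every vertex of C₂ inside D₁ ∪ … ∪ D_k. Shortcutting such a walk gives a path
-- whose edges alternate between M and non-M, and the colours of its ends decide whether it is a
-- wedge or saturated path, or, read backwards, an exposed or wedge path.

module Submission where

open import Defs
open import Data.Nat using (ℕ; zero; suc; _+_; _*_; _≤_; _<_; z≤n; _≤?_)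
open import Data.Nat.Properties
  using ( +-*-semiring; ≤-refl; <⇒≱; ≤-antisym; ≮⇒≥; <⇒≢; m≤m+n; +-mono-≤; +-mono-<-≤; +-mono-≤-<
        ; +-identityʳ; *-zeroʳ; *-comm; +-cancelˡ-≡; +-suc)
open import Data.Bool using (Bool; true; false; _∧_; _∨_; not; _xor_)
open import Data.Bool.Properties
  using (∧-assoc; ∧-comm; ∧-zeroʳ; ∧-identityʳ; ∨-identityʳ; ∨-zeroʳ; not-involutive; ¬-not)
  renaming (_≟_ to _≟ᵇ_)
open import Data.Fin using (Fin; zero; suc; inject₁; fromℕ; _≟_)
open import Data.Fin.Properties using (any?; all?)
open import Data.Fin.Induction using (<-weakInduction)
open import Data.Fin.Subset using (Subset; _∈_; _∉_; ∣_∣)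
open import Data.Fin.Subset.Properties using (_∈?_; anySubset?)
open import Data.Vec using (tabulate)
open import Data.Product using (Σ; _×_; _,_; ∃-syntax; proj₁; proj₂)
open import Data.Sum using (_⊎_; inj₁; inj₂)
open import Data.Empty using (⊥-elim)
open import Data.Unit using (⊤; tt)
open import Function using (_∘_; id; flip)
open import Relation.Nullary using (¬_; Dec; yes; no; contradiction)
open import Relation.Nullary.Decidable
  using (⌊_⌋; _×-dec_; _⊎-dec_; ¬?; dec-true; dec-false; isYes≗does; ⌊⌋-map′; decidable-stable)
open import Relation.Binary.PropositionalEquality
  using (_≡_; _≢_; refl; sym; trans; cong; cong₂; subst; subst₂; module ≡-Reasoning)
open import Relation.Binary.Construct.Closure.ReflexiveTransitive using (Star; ε; _◅_; _◅◅_; map; reverse)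
open import Algebra.Properties.Semiring.Sum +-*-semiring
  using (sum; sum-cong-≗; sum-replicate-zero; ∑-distrib-+; ∑-comm; *-distribˡ-sum)

bit : Bool → ℕ
bit true  = 1
bit false = 0

bit-not+bit : ∀ a → bit (not a) + bit a ≡ 1
bit-not+bit true  = refl
bit-not+bit false = refl

xor-∧-self : ∀ a b t → (a xor b) ∧ (a ∧ t) ≡ not b ∧ (a ∧ t)
xor-∧-self true  _     _ = refl
xor-∧-self false true  _ = refl
xor-∧-self false false _ = refl

xor-∧-not-self : ∀ a b t → (a xor b) ∧ (not a ∧ t) ≡ not a ∧ (b ∧ t)
xor-∧-not-self true  true  _ = refl
xor-∧-not-self true  false _ = refl
xor-∧-not-self false _     _ = refl

⌊≟⌋-refl : ∀ {k} (v : Fin k) → ⌊ v ≟ v ⌋ ≡ true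
⌊≟⌋-refl v = trans (isYes≗does (v ≟ v)) (dec-true (v ≟ v) refl)

⌊≟⌋-≢ : ∀ {k} {v w : Fin k} → v ≢ w → ⌊ v ≟ w ⌋ ≡ false
⌊≟⌋-≢ {v = v} {w} v≢w = trans (isYes≗does (v ≟ w)) (dec-false (v ≟ w) v≢w)

count : ∀ {k} → (Fin k → Bool) → ℕ
count h = sum (bit ∘ h)

∣tabulate∣≡count : ∀ {k} (h : Fin k → Bool) → ∣ tabulate h ∣ ≡ count h
∣tabulate∣≡count {zero}  h = refl
∣tabulate∣≡count {suc k} h with h zero
... | true  = cong suc (∣tabulate∣≡count (h ∘ suc))
... | false = ∣tabulate∣≡count (h ∘ suc)

count-cong : ∀ {k} {h h′ : Fin k → Bool} → (∀ i → h i ≡ h′ i) → count h ≡ count h′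
count-cong h≗h′ = sum-cong-≗ (cong bit ∘ h≗h′)

count-true : ∀ {k} → count {k} (λ _ → true) ≡ k
count-true {zero}  = refl
count-true {suc k} = cong suc (count-true {k})

count-split : ∀ {k} (h c : Fin k → Bool) →
              count h ≡ count (λ i → c i ∧ h i) + count (λ i → not (c i) ∧ h i)
count-split h c = trans (sum-cong-≗ split) (∑-distrib-+ (λ i → bit (c i ∧ h i)) (λ i → bit (not (c i) ∧ h i)))
  where
  split : ∀ i → bit (h i) ≡ bit (c i ∧ h i) + bit (not (c i) ∧ h i)
  split i with c i
  ... | true  = sym (+-identityʳ _)
  ... | false = refl

count-exclusive : ∀ {k} (h c c′ : Fin k → Bool) →
                  count (λ i → c i ∧ h i) ≡ count (λ i → c′ i ∧ h i) →
                  count (λ i → not (c′ i) ∧ (c i ∧ h i)) ≡ count (λ i → not (c i) ∧ (c′ i ∧ h i))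
count-exclusive h c c′ same = +-cancelˡ-≡ (count (λ i → c′ i ∧ (c i ∧ h i))) _ _ (begin
  count (λ i → c′ i ∧ (c i ∧ h i)) + count (λ i → not (c′ i) ∧ (c i ∧ h i))
    ≡⟨ count-split (λ i → c i ∧ h i) c′ ⟨
  count (λ i → c i ∧ h i)
    ≡⟨ same ⟩
  count (λ i → c′ i ∧ h i)
    ≡⟨ count-split (λ i → c′ i ∧ h i) c ⟩
  count (λ i → c i ∧ (c′ i ∧ h i)) + count (λ i → not (c i) ∧ (c′ i ∧ h i))
    ≡⟨ cong (_+ count (λ i → not (c i) ∧ (c′ i ∧ h i))) (count-cong (λ i → ∧-swapˡ (c i) (c′ i) (h i))) ⟩
  count (λ i → c′ i ∧ (c i ∧ h i)) + count (λ i → not (c i) ∧ (c′ i ∧ h i)) ∎)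
  where
  open ≡-Reasoning
  ∧-swapˡ : ∀ x y z → x ∧ (y ∧ z) ≡ y ∧ (x ∧ z)
  ∧-swapˡ x y z = trans (sym (∧-assoc x y z)) (trans (cong (_∧ z) (∧-comm x y)) (∧-assoc y x z))

sum-mono-≤ : ∀ {k} {f g : Fin k → ℕ} → (∀ i → f i ≤ g i) → sum f ≤ sum g
sum-mono-≤ {zero}  f≤g = z≤n
sum-mono-≤ {suc k} f≤g = +-mono-≤ (f≤g zero) (sum-mono-≤ (f≤g ∘ suc))

sum-mono-< : ∀ {k} {f g : Fin k → ℕ} → (∀ i → f i ≤ g i) → ∀ j → f j < g j → sum f < sum g
sum-mono-< {suc k} f≤g zero    fj<gj = +-mono-<-≤ fj<gj (sum-mono-≤ (f≤g ∘ suc))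
sum-mono-< {suc k} f≤g (suc j) fj<gj = +-mono-≤-< (f≤g zero) (sum-mono-< (f≤g ∘ suc) j fj<gj)

count-< : ∀ {k} {h h′ : Fin k → Bool} → (∀ i → h i ≡ true → h′ i ≡ true) →
          ∀ j → h j ≡ false → h′ j ≡ true → count h < count h′
count-< {h = h} {h′} h⇒h′ j hj h′j =
  sum-mono-< bit-mono j (subst₂ (λ a a′ → bit a < bit a′) (sym hj) (sym h′j) ≤-refl)
  where
  bit-mono : ∀ i → bit (h i) ≤ bit (h′ i)
  bit-mono i with h i in hi
  ... | false = z≤n
  ... | true  rewrite h⇒h′ i hi = ≤-refl

count<size : ∀ {k} (h : Fin k → Bool) j → h j ≡ false → count h < k
count<size h j hj = subst (count h <_) count-true (count-< (λ _ _ → refl) j hj refl)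

sum-select : ∀ {k} (v : Fin k) (g : Fin k → ℕ) → sum (λ w → bit ⌊ v ≟ w ⌋ * g w) ≡ g v
sum-select {suc k} zero    g = trans (cong (g zero + 0 +_) (sum-replicate-zero k)) (trans (+-identityʳ _) (+-identityʳ _))
sum-select {suc k} (suc v) g =
  trans (sum-cong-≗ (λ w → cong (λ b → bit b * g (suc w)) (⌊⌋-map′ _ _ (v ≟ w)))) (sum-select v (g ∘ suc))

count-insert : ∀ {k} (h : Fin k → Bool) v → h v ≡ false → count (λ w → ⌊ v ≟ w ⌋ ∨ h w) ≡ suc (count h)
count-insert h v hv = begin
  count (λ w → ⌊ v ≟ w ⌋ ∨ h w)                    ≡⟨ sum-cong-≗ disjoint ⟩
  sum (λ w → bit ⌊ v ≟ w ⌋ * 1 + bit (h w))       ≡⟨ ∑-distrib-+ (λ w → bit ⌊ v ≟ w ⌋ * 1) (bit ∘ h) ⟩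
  sum (λ w → bit ⌊ v ≟ w ⌋ * 1) + count h           ≡⟨ cong (_+ count h) (sum-select v (λ _ → 1)) ⟩
  suc (count h)                                     ∎
  where
  open ≡-Reasoning
  disjoint : ∀ w → bit (⌊ v ≟ w ⌋ ∨ h w) ≡ bit ⌊ v ≟ w ⌋ * 1 + bit (h w)
  disjoint w with v ≟ w
  ... | yes refl rewrite hv = refl
  ... | no _     = refl

count-fibres : ∀ {k l} (R : Fin k → Bool) (P : Fin l → Bool) (a : Fin l → Fin k) →
               sum (λ v → bit (R v) * count (λ e → P e ∧ ⌊ a e ≟ v ⌋)) ≡ count (λ e → P e ∧ R (a e))
count-fibres R P a = begin
  sum (λ v → bit (R v) * count (λ e → P e ∧ ⌊ a e ≟ v ⌋))
    ≡⟨ sum-cong-≗ (λ v → *-distribˡ-sum (bit (R v)) (λ e → bit (P e ∧ ⌊ a e ≟ v ⌋))) ⟩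
  sum (λ v → sum (λ e → bit (R v) * bit (P e ∧ ⌊ a e ≟ v ⌋)))
    ≡⟨ ∑-comm (λ v e → bit (R v) * bit (P e ∧ ⌊ a e ≟ v ⌋)) ⟩
  sum (λ e → sum (λ v → bit (R v) * bit (P e ∧ ⌊ a e ≟ v ⌋)))
    ≡⟨ sum-cong-≗ (λ e → sum-cong-≗ (λ v → swap (R v) (P e) ⌊ a e ≟ v ⌋)) ⟩
  sum (λ e → sum (λ v → bit ⌊ a e ≟ v ⌋ * bit (P e ∧ R v)))
    ≡⟨ sum-cong-≗ (λ e → sum-select (a e) (λ v → bit (P e ∧ R v))) ⟩
  count (λ e → P e ∧ R (a e)) ∎
  where
  open ≡-Reasoning
  swap : ∀ r p d → bit r * bit (p ∧ d) ≡ bit d * bit (p ∧ r)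
  swap r false d = trans (*-zeroʳ (bit r)) (sym (*-zeroʳ (bit d)))
  swap r true  d = *-comm (bit r) (bit d)

module Reachability {k} (S : Fin k → Fin k → Set) (S? : ∀ u v → Dec (S u v)) (s t : Fin k) where

  record Separator : Set where
    field
      member     : Fin k → Bool
      source-in  : member s ≡ true
      target-out : member t ≡ false
      reached    : ∀ v → member v ≡ true → Star S s v
      closed     : ∀ u v → member u ≡ true → S u v → member v ≡ true

  private
    stop : (R : Fin k → Bool) → R s ≡ true → (∀ v → R v ≡ true → Star S s v) →
           (∀ u v → R u ≡ true → S u v → R v ≡ true) → Star S s t ⊎ Separator
    stop R Rs reach closed with R t ≟ᵇ true
    ... | yes Rt = inj₁ (reach t Rt)
    ... | no ¬Rt = inj₂ (record
      { member = R ; source-in = Rs ; target-out = ¬-not ¬Rt ; reached = reach ; closed = closed })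

    -- Each round adds a vertex to R, so the fuel bound k ≤ fuel + |R| cannot fail.
    grow : ∀ fuel (R : Fin k → Bool) → R s ≡ true → (∀ v → R v ≡ true → Star S s v) →
           k ≤ fuel + count R → Star S s t ⊎ Separator
    grow fuel R Rs reach bound
      with any? (λ u → any? (λ v → ((R u ≟ᵇ true) ×-dec (R v ≟ᵇ false)) ×-dec S? u v))
    grow zero       R Rs reach bound | yes (_ , v , (_ , Rv) , _) = contradiction bound (<⇒≱ (count<size R v Rv))
    grow (suc fuel) R Rs reach bound | yes (u , v , (Ru , Rv) , uv) =
      grow fuel R′ (trans (cong (⌊ v ≟ s ⌋ ∨_) Rs) (∨-zeroʳ _)) reach′ bound′
      where
      R′ : Fin k → Bool
      R′ w = ⌊ v ≟ w ⌋ ∨ R w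
      reach′ : ∀ w → R′ w ≡ true → Star S s w
      reach′ w R′w with v ≟ w
      ... | yes refl = reach u Ru ◅◅ (uv ◅ ε)
      ... | no _     = reach w R′w
      bound′ : k ≤ fuel + count R′
      bound′ = subst (k ≤_) (trans (sym (+-suc fuel (count R))) (cong (fuel +_) (sym (count-insert R v Rv)))) bound
    grow fuel R Rs reach bound | no stuck = stop R Rs reach closed
      where
      closed : ∀ u v → R u ≡ true → S u v → R v ≡ true
      closed u v Ru uv with R v ≟ᵇ true
      ... | yes Rv = Rv
      ... | no ¬Rv = contradiction (u , v , (Ru , ¬-not ¬Rv) , uv) stuck

  reachable-or-separated : Star S s t ⊎ Separator
  reachable-or-separated = grow k (λ w → ⌊ s ≟ w ⌋) (⌊≟⌋-refl s) from-s (m≤m+n k _)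
    where
    from-s : ∀ v → ⌊ s ≟ v ⌋ ≡ true → Star S s v
    from-s v _  with s ≟ v
    from-s v _  | yes refl = ε
    from-s v () | no _

module Digraph {k l} (tail head : Fin l → Fin k) (arc : Fin l → Bool) where

  outdeg indeg : Fin k → ℕ
  outdeg v = count (λ e → arc e ∧ ⌊ tail e ≟ v ⌋)
  indeg  v = count (λ e → arc e ∧ ⌊ head e ≟ v ⌋)

  -- Summed over R, outdeg and indeg count the arcs with tail resp. head in R; closure makes the
  -- former a subset of the latter, balance makes them equally many, so no arc enters R from outside.
  balanced-out-closed⇒in-closed : (R : Fin k → Bool) →
    (∀ e → arc e ≡ true → R (tail e) ≡ true → R (head e) ≡ true) →
    (∀ v → R v ≡ true → outdeg v ≡ indeg v) →
    ∀ e → arc e ≡ true → R (head e) ≡ true → R (tail e) ≡ true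
  balanced-out-closed⇒in-closed R out-closed balanced e arc-e R-head with R (tail e) in R-tail
  ... | true  = refl
  ... | false = contradiction same (<⇒≢ fewer)
    where
    open ≡-Reasoning
    weighted : ∀ v → bit (R v) * outdeg v ≡ bit (R v) * indeg v
    weighted v with R v in Rv
    ... | true  = cong (1 *_) (balanced v Rv)
    ... | false = refl
    same : count (λ e → arc e ∧ R (tail e)) ≡ count (λ e → arc e ∧ R (head e))
    same = begin
      count (λ e → arc e ∧ R (tail e))      ≡⟨ count-fibres R arc tail ⟨
      sum (λ v → bit (R v) * outdeg v)      ≡⟨ sum-cong-≗ weighted ⟩
      sum (λ v → bit (R v) * indeg v)       ≡⟨ count-fibres R arc head ⟩
      count (λ e → arc e ∧ R (head e))      ∎
    tail⇒head : ∀ f → arc f ∧ R (tail f) ≡ true → arc f ∧ R (head f) ≡ true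
    tail⇒head f _  with arc f in arc-f | R (tail f) in R-tail-f
    tail⇒head f _  | true  | true rewrite out-closed f arc-f R-tail-f = refl
    tail⇒head f () | true  | false
    tail⇒head f () | false | _
    fewer : count (λ e → arc e ∧ R (tail e)) < count (λ e → arc e ∧ R (head e))
    fewer = count-< tail⇒head e (cong₂ _∧_ arc-e R-tail) (cong₂ _∧_ arc-e R-head)

module Walks {k} {S : Fin k → Fin k → Set} where

  OnWalk : ∀ {x y} → Fin k → Star S x y → Set
  OnWalk {x} v ε       = v ≡ x
  OnWalk {x} v (_ ◅ p) = v ≡ x ⊎ OnWalk v p

  Fresh : ∀ {x y} → Star S x y → Set
  Fresh     ε       = ⊤
  Fresh {x} (_ ◅ p) = ¬ OnWalk x p × Fresh p

  onWalk? : ∀ {x y} v (p : Star S x y) → Dec (OnWalk v p)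
  onWalk? v ε       = v ≟ _
  onWalk? v (_ ◅ p) = (v ≟ _) ⊎-dec onWalk? v p

  walk-start-on : ∀ {x y} (p : Star S x y) → OnWalk x p
  walk-start-on ε       = refl
  walk-start-on (_ ◅ _) = inj₁ refl

  walk-end-on : ∀ {x y} (p : Star S x y) → OnWalk y p
  walk-end-on ε       = refl
  walk-end-on (_ ◅ p) = inj₂ (walk-end-on p)

  walk-closed : ∀ {P : Fin k → Set} → (∀ {u w} → S u w → P w) →
                ∀ {x y} (p : Star S x y) → P x → ∀ {v} → OnWalk v p → P v
  walk-closed into ε       Px refl        = Px
  walk-closed into (_ ◅ p) Px (inj₁ refl) = Px
  walk-closed into (s ◅ p) Px (inj₂ v∈p)  = walk-closed into p (into s) v∈p

  suffix : ∀ {x y} (p : Star S x y) → Fresh p → ∀ {v} → OnWalk v p → Σ (Star S v y) Fresh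
  suffix ε       _        refl        = ε , tt
  suffix (s ◅ p) fr       (inj₁ refl) = s ◅ p , fr
  suffix (_ ◅ p) (_ , fr) (inj₂ v∈p)  = suffix p fr v∈p

  shortcut : ∀ {x y} → Star S x y → Σ (Star S x y) Fresh
  shortcut ε = ε , tt
  shortcut {x} (s ◅ p) with shortcut p
  ... | q , frq with onWalk? x q
  ...   | yes x∈q = suffix q frq x∈q
  ...   | no  x∉q = s ◅ q , x∉q , frq

Mutual : ∀ {k} → (Fin k → Fin k → Set) → Fin k → Fin k → Set
Mutual S u w = Star S u w × Star S w u

mutual-sym : ∀ {k} {S : Fin k → Fin k → Set} {u w} → Mutual S u w → Mutual S w u
mutual-sym (there , back) = back , there

mutual-trans : ∀ {k} {S : Fin k → Fin k → Set} {u v w} → Mutual S u v → Mutual S v w → Mutual S u w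
mutual-trans (uv , vu) (vw , wv) = uv ◅◅ vw , wv ◅◅ vu

module _ (G : BGraph) where
  open BGraph G
  open Path

  pathDegree : (Fin m → Bool) → Path G → Fin n → ℕ
  pathDegree c P v = ∣ tabulate (λ i → c (es P i) ∧ (⌊ vs P (inject₁ i) ≟ v ⌋ ∨ ⌊ vs P (suc i) ≟ v ⌋)) ∣

  -- Wedge G M, Saturated G M and Exposed G M are, definitionally, WedgeBy and SaturatedBy
  -- for the colourings e ↦ [e ∈ M] and e ↦ [e ∉ M].
  WedgeBy SaturatedBy : (Fin m → Bool) → Path G → Fin n → Fin n → Set
  WedgeBy c P x y = HasEnds G P x y
    × (∀ v → OnP G P v → v ≢ y → pathDegree c P v ≡ 1)
    × pathDegree c P y ≡ 0
  SaturatedBy c P x y = HasEnds G P x y × (∀ v → OnP G P v → pathDegree c P v ≡ 1)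

module WalkPaths (G : BGraph) {S : Fin (BGraph.n G) → Fin (BGraph.n G) → Set}
                 (edge : ∀ {u w} → S u w → ∃[ f ] Joins G f u w) where
  open BGraph G
  open Walks {S = S}

  walkLength : ∀ {x y} → Star S x y → ℕ
  walkLength ε       = 0
  walkLength (_ ◅ p) = suc (walkLength p)

  vertex : ∀ {x y} (p : Star S x y) → Fin (suc (walkLength p)) → Fin n
  vertex {x} ε       _       = x
  vertex {x} (_ ◅ _) zero    = x
  vertex     (_ ◅ p) (suc i) = vertex p i

  edgeAt : ∀ {x y} (p : Star S x y) → Fin (walkLength p) → Fin m
  edgeAt (s ◅ _) zero    = proj₁ (edge s)
  edgeAt (_ ◅ p) (suc i) = edgeAt p i

  vertex-zero : ∀ {x y} (p : Star S x y) → vertex p zero ≡ x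
  vertex-zero ε       = refl
  vertex-zero (_ ◅ _) = refl

  vertex-last : ∀ {x y} (p : Star S x y) → vertex p (fromℕ (walkLength p)) ≡ y
  vertex-last ε       = refl
  vertex-last (_ ◅ p) = vertex-last p

  edgeAt-joins : ∀ {x y} (p : Star S x y) i → Joins G (edgeAt p i) (vertex p (inject₁ i)) (vertex p (suc i))
  edgeAt-joins (s ◅ p) zero    = subst (Joins G (proj₁ (edge s)) _) (sym (vertex-zero p)) (proj₂ (edge s))
  edgeAt-joins (_ ◅ p) (suc i) = edgeAt-joins p i

  vertex-on : ∀ {x y} (p : Star S x y) i → OnWalk (vertex p i) p
  vertex-on ε       _       = refl
  vertex-on (_ ◅ _) zero    = inj₁ refl
  vertex-on (_ ◅ p) (suc i) = inj₂ (vertex-on p i)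

  vertex-injective : ∀ {x y} (p : Star S x y) → Fresh p → ∀ {i j} → vertex p i ≡ vertex p j → i ≡ j
  vertex-injective ε       _        {zero}  {zero}  _  = refl
  vertex-injective (_ ◅ _) _        {zero}  {zero}  _  = refl
  vertex-injective (_ ◅ p) (x∉p , _) {zero}  {suc j} eq = ⊥-elim (x∉p (subst (λ z → OnWalk z p) (sym eq) (vertex-on p j)))
  vertex-injective (_ ◅ p) (x∉p , _) {suc i} {zero}  eq = ⊥-elim (x∉p (subst (λ z → OnWalk z p) eq (vertex-on p i)))
  vertex-injective (_ ◅ p) (_ , fr)  {suc i} {suc j} eq = cong suc (vertex-injective p fr eq)

  toPath : ∀ {x y} (p : Star S x y) → Fresh p → Path G
  toPath p fr = record
    { len = walkLength p ; vs = vertex p ; vs-inj = vertex-injective p fr ; es = edgeAt p ; joins = edgeAt-joins p }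

  toPath-ends : ∀ {x y} (p : Star S x y) (fr : Fresh p) → HasEnds G (toPath p fr) x y
  toPath-ends p _ = vertex-zero p , vertex-last p

  toPath-on : ∀ {x y} (p : Star S x y) (fr : Fresh p) {v} → OnP G (toPath p fr) v → OnWalk v p
  toPath-on p _ (i , refl) = vertex-on p i

  simplePath : ∀ {P : Fin n → Set} → (∀ {u w} → S u w → P w) → ∀ {x y} → Star S x y → P x →
               Σ (Star S x y) λ p → Σ (Fresh p) λ fr → ∀ v → OnP G (toPath p fr) v → P v
  simplePath into walk Px with shortcut walk
  ... | p , fr = p , fr , λ v on → walk-closed into p Px (toPath-on p fr on)

  walkDegree : (Fin m → Bool) → ∀ {x y} → Star S x y → Fin n → ℕ
  walkDegree c     ε                   v = 0
  walkDegree c {x} (_◅_ {j = w} s p) v = bit (c (proj₁ (edge s)) ∧ (⌊ x ≟ v ⌋ ∨ ⌊ w ≟ v ⌋)) + walkDegree c p v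

  pathDegree-toPath : ∀ c {x y} (p : Star S x y) (fr : Fresh p) v → pathDegree G c (toPath p fr) v ≡ walkDegree c p v
  pathDegree-toPath c p fr v = trans (∣tabulate∣≡count (atEdge p)) (along p)
    where
    atEdge : ∀ {x y} (p : Star S x y) → Fin (walkLength p) → Bool
    atEdge p i = c (edgeAt p i) ∧ (⌊ vertex p (inject₁ i) ≟ v ⌋ ∨ ⌊ vertex p (suc i) ≟ v ⌋)
    along : ∀ {x y} (p : Star S x y) → count (atEdge p) ≡ walkDegree c p v
    along ε       = refl
    along {x} (s ◅ p) =
      cong₂ _+_ (cong (λ w → bit (c (proj₁ (edge s)) ∧ (⌊ x ≟ v ⌋ ∨ ⌊ w ≟ v ⌋))) (vertex-zero p)) (along p)

  module Alternating (c : Fin m → Bool) (κ : Fin n → Bool)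
    (alternates : ∀ {u w} (s : S u w) → c (proj₁ (edge s)) ≡ κ u × c (proj₁ (edge s)) ≡ not (κ w)) where

    -- The edge of a path entering v (there is one unless v = x) is c-coloured iff ¬ κ v,
    -- the edge leaving v (unless v = y) iff κ v.
    expectedDegree : Fin n → Fin n → Fin n → ℕ
    expectedDegree x y v = bit (not ⌊ x ≟ v ⌋ ∧ not (κ v)) + bit (not ⌊ y ≟ v ⌋ ∧ κ v)

    walkDegree-off : ∀ {x y} (p : Star S x y) {v} → ¬ OnWalk v p → walkDegree c p v ≡ 0
    walkDegree-off ε _ = refl
    walkDegree-off {x} (_◅_ {j = w} s p) {v} v∉
      rewrite ⌊≟⌋-≢ {v = x} {v} (λ x≡v → v∉ (inj₁ (sym x≡v)))
            | ⌊≟⌋-≢ {v = w} {v} (λ w≡v → v∉ (inj₂ (subst (λ z → OnWalk z p) w≡v (walk-start-on p))))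
            | ∧-zeroʳ (c (proj₁ (edge s))) = walkDegree-off p (v∉ ∘ inj₂)

    walkDegree-on : ∀ {x y} (p : Star S x y) → Fresh p → ∀ v → OnWalk v p → walkDegree c p v ≡ expectedDegree x y v
    walkDegree-on {x} ε _ .x refl rewrite ⌊≟⌋-refl x = refl
    walkDegree-on {x} {y} (_◅_ {j = w} s p) (x∉p , fr) v v∈ with x ≟ v
    ... | yes refl
      rewrite walkDegree-off p x∉p
            | ⌊≟⌋-≢ {v = y} {x} (λ y≡x → x∉p (subst (λ z → OnWalk z p) y≡x (walk-end-on p)))
            | proj₁ (alternates s) | ∧-identityʳ (κ x) = +-identityʳ _
    ... | no x≢v with v∈
    ...   | inj₁ v≡x = ⊥-elim (x≢v (sym v≡x))
    ...   | inj₂ v∈p with w ≟ v | walkDegree-on p fr v v∈p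
    ...     | yes refl | IH rewrite IH | proj₂ (alternates s) | ∧-identityʳ (not (κ w)) = refl
    ...     | no _     | IH rewrite ∧-zeroʳ (c (proj₁ (edge s))) = IH

    toPath-wedge : ∀ {x y} (p : Star S x y) (fr : Fresh p) → κ x ≡ true → κ y ≡ true →
                   WedgeBy G c (toPath p fr) x y
    toPath-wedge {x} {y} p fr κx κy = toPath-ends p fr , inner , at-end
      where
      inner : ∀ v → OnP G (toPath p fr) v → v ≢ y → pathDegree G c (toPath p fr) v ≡ 1
      inner v on v≢y rewrite pathDegree-toPath c p fr v | walkDegree-on p fr v (toPath-on p fr on)
                           | ⌊≟⌋-≢ (v≢y ∘ sym) with x ≟ v
      ... | yes refl rewrite κx = refl
      ... | no _     = bit-not+bit (κ v)
      at-end : pathDegree G c (toPath p fr) y ≡ 0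
      at-end rewrite pathDegree-toPath c p fr y | walkDegree-on p fr y (walk-end-on p)
                   | ⌊≟⌋-refl y | κy | ∧-zeroʳ (not ⌊ x ≟ y ⌋) = refl

    toPath-saturated : ∀ {x y} (p : Star S x y) (fr : Fresh p) → κ x ≡ true → κ y ≡ false →
                       SaturatedBy G c (toPath p fr) x y
    toPath-saturated {x} {y} p fr κx κy = toPath-ends p fr , inner
      where
      inner : ∀ v → OnP G (toPath p fr) v → pathDegree G c (toPath p fr) v ≡ 1
      inner v on rewrite pathDegree-toPath c p fr v | walkDegree-on p fr v (toPath-on p fr on) with x ≟ v | y ≟ v
      ... | yes refl | yes refl = contradiction (trans (sym κx) κy) λ ()
      ... | yes refl | no _     rewrite κx = refl
      ... | no _     | yes refl rewrite κy = refl
      ... | no _     | no _     = bit-not+bit (κ v)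

module Bipartite (G : BGraph) where
  open BGraph G

  joins-sym : ∀ {f u w} → Joins G f u w → Joins G f w u
  joins-sym (inj₁ ends) = inj₂ ends
  joins-sym (inj₂ ends) = inj₁ ends

  joins-colours : ∀ {f u w} → Joins G f u w → inA u ≡ not (inA w)
  joins-colours {f} (inj₁ (refl , refl)) = trans (tl∈A f) (sym (cong not (hd∈B f)))
  joins-colours {f} (inj₂ (refl , refl)) = trans (hd∈B f) (sym (cong not (tl∈A f)))

  joins-same-edge : ∀ {f u w u′ w′} → Joins G f u w → Joins G f u′ w′ → (u ≡ u′ × w ≡ w′) ⊎ (u ≡ w′ × w ≡ u′)
  joins-same-edge (inj₁ (refl , refl)) (inj₁ (refl , refl)) = inj₁ (refl , refl)
  joins-same-edge (inj₁ (refl , refl)) (inj₂ (refl , refl)) = inj₂ (refl , refl)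
  joins-same-edge (inj₂ (refl , refl)) (inj₁ (refl , refl)) = inj₂ (refl , refl)
  joins-same-edge (inj₂ (refl , refl)) (inj₂ (refl , refl)) = inj₁ (refl , refl)

  endpoint : Bool → Fin m → Fin n
  endpoint true  = tl
  endpoint false = hd

  endpoint-colour : ∀ a f → inA (endpoint a f) ≡ a
  endpoint-colour true  = tl∈A
  endpoint-colour false = hd∈B

  endpoint-joins : ∀ a f → Joins G f (endpoint a f) (endpoint (not a) f)
  endpoint-joins true  _ = inj₁ (refl , refl)
  endpoint-joins false _ = inj₂ (refl , refl)

  endpoint-≢ : ∀ {a v} → a ≢ inA v → ∀ f → ⌊ endpoint a f ≟ v ⌋ ≡ false
  endpoint-≢ a≢v f = ⌊≟⌋-≢ (λ end≡v → a≢v (trans (sym (endpoint-colour _ f)) (cong inA end≡v)))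

  endpoint-at-A : ∀ {v} → inA v ≡ true → ∀ a f → ⌊ endpoint a f ≟ v ⌋ ≡ a ∧ ⌊ tl f ≟ v ⌋
  endpoint-at-A v∈A true  f = refl
  endpoint-at-A v∈A false f = endpoint-≢ {false} (λ false≡v → contradiction (trans false≡v v∈A) λ ()) f

  endpoint-at-B : ∀ {v} → inA v ≡ false → ∀ a f → ⌊ endpoint a f ≟ v ⌋ ≡ not a ∧ ⌊ hd f ≟ v ⌋
  endpoint-at-B v∈B true  f = endpoint-≢ {true} (λ true≡v → contradiction (trans true≡v v∈B) λ ()) f
  endpoint-at-B v∈B false f = refl

  inM : Subset m → Fin m → Bool
  inM M f = ⌊ f ∈? M ⌋

  ∈⇒inM : ∀ {M f} → f ∈ M → inM M f ≡ true
  ∈⇒inM {M} {f} f∈M = trans (isYes≗does (f ∈? M)) (dec-true (f ∈? M) f∈M)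

  ∉⇒inM : ∀ {M f} → f ∉ M → inM M f ≡ false
  ∉⇒inM {M} {f} f∉M = trans (isYes≗does (f ∈? M)) (dec-false (f ∈? M) f∉M)

  inM⇒∈ : ∀ {M f} → inM M f ≡ true → f ∈ M
  inM⇒∈ {M} {f} _  with f ∈? M
  inM⇒∈         _  | yes f∈M = f∈M
  inM⇒∈         () | no _

  inM⇒∉ : ∀ {M f} → inM M f ≡ false → f ∉ M
  inM⇒∉ {M} {f} _  with f ∈? M
  inM⇒∉         () | yes _
  inM⇒∉         _  | no f∉M = f∉M

  degM-at-A : ∀ M {v} → inA v ≡ true → degM G M v ≡ count (λ f → inM M f ∧ ⌊ tl f ≟ v ⌋)
  degM-at-A M {v} v∈A =
    trans (∣tabulate∣≡count (λ f → (⌊ tl f ≟ v ⌋ ∨ ⌊ hd f ≟ v ⌋) ∧ inM M f)) (count-cong λ f →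
    trans (cong (λ h → (⌊ tl f ≟ v ⌋ ∨ h) ∧ inM M f) (endpoint-at-A v∈A false f))
          (trans (cong (_∧ inM M f) (∨-identityʳ _)) (∧-comm ⌊ tl f ≟ v ⌋ (inM M f))))

  degM-at-B : ∀ M {v} → inA v ≡ false → degM G M v ≡ count (λ f → inM M f ∧ ⌊ hd f ≟ v ⌋)
  degM-at-B M {v} v∈B =
    trans (∣tabulate∣≡count (λ f → (⌊ tl f ≟ v ⌋ ∨ ⌊ hd f ≟ v ⌋) ∧ inM M f)) (count-cong λ f →
    trans (cong (λ t → (t ∨ ⌊ hd f ≟ v ⌋) ∧ inM M f) (endpoint-at-B v∈B true f)) (∧-comm ⌊ hd f ≟ v ⌋ (inM M f)))

  -- An M-edge is traversed from A to B and a non-M-edge from B to A.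
  module Oriented (M : Subset m) where

    tail head : Fin m → Fin n
    tail f = endpoint (inM M f) f
    head f = endpoint (not (inM M f)) f

    AltArc : Fin n → Fin n → Set
    AltArc u w = ∃[ f ] (Joins G f u w × inM M f ≡ inA u)

    Arc : (Fin n → Set) → Fin n → Fin n → Set
    Arc P u w = P u × AltArc u w × P w

    tail→head : ∀ f → AltArc (tail f) (head f)
    tail→head f = f , endpoint-joins (inM M f) f , sym (endpoint-colour (inM M f) f)

  module Difference (M M′ : Subset m) where
    open Oriented M

    differs : Fin m → Bool
    differs f = inM M f xor inM M′ f

    open Digraph tail head differs public

    DiffArc : Fin n → Fin n → Set
    DiffArc u w = ∃[ f ] (differs f ≡ true × tail f ≡ u × head f ≡ w)

    diffArc? : ∀ u w → Dec (DiffArc u w)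
    diffArc? u w = any? (λ f → (differs f ≟ᵇ true) ×-dec (tail f ≟ u) ×-dec (head f ≟ w))

    balanced : ∀ v → degM G M v ≡ degM G M′ v → outdeg v ≡ indeg v
    balanced v same with inA v in colour
    ... | true = begin
      outdeg v                                                   ≡⟨ count-cong leaving ⟩
      count (λ f → not (inM M′ f) ∧ (inM M f ∧ ⌊ tl f ≟ v ⌋))    ≡⟨ count-exclusive _ (inM M) (inM M′) same-at-A ⟩
      count (λ f → not (inM M f) ∧ (inM M′ f ∧ ⌊ tl f ≟ v ⌋))    ≡⟨ count-cong entering ⟨
      indeg v                                                    ∎
      where
      open ≡-Reasoning
      same-at-A = trans (sym (degM-at-A M colour)) (trans same (degM-at-A M′ colour))
      leaving : ∀ f → differs f ∧ ⌊ tail f ≟ v ⌋ ≡ not (inM M′ f) ∧ (inM M f ∧ ⌊ tl f ≟ v ⌋)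
      leaving f = trans (cong (differs f ∧_) (endpoint-at-A colour (inM M f) f)) (xor-∧-self (inM M f) (inM M′ f) _)
      entering : ∀ f → differs f ∧ ⌊ head f ≟ v ⌋ ≡ not (inM M f) ∧ (inM M′ f ∧ ⌊ tl f ≟ v ⌋)
      entering f = trans (cong (differs f ∧_) (endpoint-at-A colour (not (inM M f)) f)) (xor-∧-not-self (inM M f) (inM M′ f) _)
    ... | false = begin
      outdeg v                                                   ≡⟨ count-cong leaving ⟩
      count (λ f → not (inM M f) ∧ (inM M′ f ∧ ⌊ hd f ≟ v ⌋))    ≡⟨ count-exclusive _ (inM M) (inM M′) same-at-B ⟨
      count (λ f → not (inM M′ f) ∧ (inM M f ∧ ⌊ hd f ≟ v ⌋))    ≡⟨ count-cong entering ⟨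
      indeg v                                                    ∎
      where
      open ≡-Reasoning
      same-at-B = trans (sym (degM-at-B M colour)) (trans same (degM-at-B M′ colour))
      leaving : ∀ f → differs f ∧ ⌊ tail f ≟ v ⌋ ≡ not (inM M f) ∧ (inM M′ f ∧ ⌊ hd f ≟ v ⌋)
      leaving f = trans (cong (differs f ∧_) (endpoint-at-B colour (inM M f) f)) (xor-∧-not-self (inM M f) (inM M′ f) _)
      entering : ∀ f → differs f ∧ ⌊ head f ≟ v ⌋ ≡ not (inM M′ f) ∧ (inM M f ∧ ⌊ hd f ≟ v ⌋)
      entering f = trans (cong (differs f ∧_) (trans (endpoint-at-B colour (not (inM M f)) f)
                                                      (cong (_∧ ⌊ hd f ≟ v ⌋) (not-involutive _))))
                         (xor-∧-self (inM M f) (inM M′ f) _)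

module Matchings (G : BGraph) (b : Fin (BGraph.n G) → ℕ) where
  open BGraph G
  open Bipartite G

  isBMatching? : ∀ M → Dec (IsBMatching G b M)
  isBMatching? M = all? (λ v → degM G M v ≤? b v)

  isMaxBMatching? : ∀ M → Dec (IsMaxBMatching G b M)
  isMaxBMatching? M with isBMatching? M | anySubset? (λ M′ → isBMatching? M′ ×-dec ¬? (∣ M′ ∣ ≤? ∣ M ∣))
  ... | no ¬bm | _                  = no (¬bm ∘ proj₁)
  ... | yes _  | yes (M′ , bm′ , ≰) = no (λ mx → ≰ (proj₂ mx M′ bm′))
  ... | yes bm | no ∄               =
    yes (bm , λ M′ bm′ → decidable-stable (∣ M′ ∣ ≤? ∣ M ∣) (λ ≰ → ∄ (M′ , bm′ , ≰)))

  max-saturates : ∀ {M} → IsMaxBMatching G b M → ∀ {v} → ¬ InD G b v → degM G M v ≡ b v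
  max-saturates mx v∉D = ≤-antisym (proj₁ mx _) (≮⇒≥ (λ loose → v∉D (_ , mx , loose)))

  differs⇒flexible : ∀ {M M′ f} → IsMaxBMatching G b M → IsMaxBMatching G b M′ →
                     inM M f xor inM M′ f ≡ true → Flexible G b f
  differs⇒flexible {M} {M′} {f} mx mx′ _ with inM M f in f∈M | inM M′ f in f∈M′
  ... | true  | false = (M , mx , inM⇒∈ f∈M) , λ inevitable → inM⇒∉ f∈M′ (proj₂ inevitable M′ mx′)
  ... | false | true  = (M′ , mx′ , inM⇒∈ f∈M′) , λ inevitable → inM⇒∉ f∈M (proj₂ inevitable M mx)
  differs⇒flexible mx mx′ () | true  | true
  differs⇒flexible mx mx′ () | false | false

  flexible⇒differs : ∀ {M f} → IsMaxBMatching G b M → Flexible G b f →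
                     ∃[ M′ ] (IsMaxBMatching G b M′ × inM M f xor inM M′ f ≡ true)
  flexible⇒differs {M} {f} mx ((M₁ , mx₁ , f∈M₁) , not-inevitable) with inM M f
  ... | false = M₁ , mx₁ , ∈⇒inM f∈M₁
  ... | true  with anySubset? (λ M′ → isMaxBMatching? M′ ×-dec ¬? (f ∈? M′))
  ...   | yes (M′ , mx′ , f∉M′) = M′ , mx′ , cong not (∉⇒inM f∉M′)
  ...   | no ∄ = contradiction
    ((M₁ , mx₁ , f∈M₁) , λ M″ mx″ → decidable-stable (f ∈? M″) (λ f∉M″ → ∄ (M″ , mx″ , f∉M″)))
    not-inevitable

module Components (G : BGraph) (b : Fin (BGraph.n G) → ℕ) (M : Subset (BGraph.m G)) (mx : IsMaxBMatching G b M) where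
  open BGraph G
  open Bipartite G
  open Matchings G b
  open Oriented M

  precA⇒arc : ∀ {r r′} → PrecA G b r r′ →
              SameComp G b r r′ ⊎ ∃[ u ] ∃[ w ] (InComp G b r u × AltArc u w × InComp G b r′ w)
  precA⇒arc (inj₁ same) = inj₁ same
  precA⇒arc (inj₂ (inj₁ (e , inevitable , tl∈r , hd∈r′))) =
    inj₂ (tl e , hd e , tl∈r , (e , inj₁ (refl , refl) , trans (∈⇒inM (proj₂ inevitable M mx)) (sym (tl∈A e))) , hd∈r′)
  precA⇒arc (inj₂ (inj₂ (e , forbidden , tl∈r′ , hd∈r))) =
    inj₂ (hd e , tl e , hd∈r ,
          (e , inj₂ (refl , refl) , trans (∉⇒inM (λ e∈M → forbidden (M , mx , e∈M))) (sym (hd∈B e))) , tl∈r′)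

  module StronglyConnected (r : Fin n) (consistent : Consistent G b r) where

    T : Fin n → Fin n → Set
    T = Arc (InComp G b r)

    module _ {M′ : Subset m} (mx′ : IsMaxBMatching G b M′) where
      open Difference M M′

      diff⇒flex : ∀ {u w} → DiffArc u w → FlexStep G b u w
      diff⇒flex (f , d , refl , refl) = f , differs⇒flexible mx mx′ d , endpoint-joins (inM M f) f

      diff⇒alt : ∀ {u w} → DiffArc u w → AltArc u w
      diff⇒alt (f , _ , refl , refl) = tail→head f

      lift : ∀ {u w} → InComp G b r u → Star DiffArc u w → Star T u w
      lift cu ε       = ε
      lift cu (s ◅ p) = (cu , diff⇒alt s , cw) ◅ lift cw p
        where cw = cu ◅◅ (diff⇒flex s ◅ ε)

      -- Everything reached from the head of f lies in the consistent component, hence outside 𝒟,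
      -- where both matchings saturate b and so M Δ M′ is balanced.
      no-separator : ∀ {f} → differs f ≡ true → InComp G b r (head f) →
                     ¬ Reachability.Separator DiffArc diffArc? (head f) (tail f)
      no-separator {f} d ch sep =
        contradiction (trans (sym (balanced-out-closed⇒in-closed member closed′ balanced′ f d source-in)) target-out)
                      λ ()
        where
        open Reachability.Separator sep
        closed′ : ∀ e → differs e ≡ true → member (tail e) ≡ true → member (head e) ≡ true
        closed′ e de Re = closed (tail e) (head e) Re (e , de , refl , refl)
        balanced′ : ∀ v → member v ≡ true → outdeg v ≡ indeg v
        balanced′ v Rv = balanced v (trans (max-saturates mx v∉D) (sym (max-saturates mx′ v∉D)))
          where
          v∉D : ¬ InD G b v
          v∉D v∈D = consistent (inj₁ (v , ch ◅◅ map diff⇒flex (reached v Rv) , v∈D))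

      back-along-difference : ∀ {f} → differs f ≡ true → InComp G b r (head f) → Star T (head f) (tail f)
      back-along-difference {f} d ch with Reachability.reachable-or-separated DiffArc diffArc? (head f) (tail f)
      ... | inj₁ walk = lift ch walk
      ... | inj₂ sep  = ⊥-elim (no-separator {f} d ch sep)

    flexible-mutual : ∀ {f} → Flexible G b f → InComp G b r (tail f) → Mutual T (tail f) (head f)
    flexible-mutual {f} fl ct with flexible⇒differs mx fl
    ... | M′ , mx′ , d = (ct , tail→head f , ch) ◅ ε , back-along-difference mx′ {f} d ch
      where ch = ct ◅◅ ((f , fl , endpoint-joins (inM M f) f) ◅ ε)

    flexStep-mutual : ∀ {u w} → InComp G b r u → FlexStep G b u w → Mutual T u w
    flexStep-mutual cu step@(f , fl , joins) with joins-same-edge joins (endpoint-joins (inM M f) f)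
    ... | inj₁ (refl , refl) = flexible-mutual fl cu
    ... | inj₂ (refl , refl) = mutual-sym (flexible-mutual fl (cu ◅◅ (step ◅ ε)))

    flexWalk-mutual : ∀ {u w} → InComp G b r u → Star (FlexStep G b) u w → Mutual T u w
    flexWalk-mutual cu ε       = ε , ε
    flexWalk-mutual cu (s ◅ p) = mutual-trans (flexStep-mutual cu s) (flexWalk-mutual (cu ◅◅ (s ◅ ε)) p)

    strongly-connected : ∀ {u w} → InComp G b r u → InComp G b r w → Star T u w
    strongly-connected cu cw = proj₂ (flexWalk-mutual ε cu) ◅◅ proj₁ (flexWalk-mutual ε cw)

  open StronglyConnected using (strongly-connected)

  module Chain (j : ℕ) (D : Fin (suc j) → Fin n) (consistent : ∀ i → Consistent G b (D i))
               (prec : ∀ (i : Fin j) → PrecA G b (D (inject₁ i)) (D (suc i))) where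

    Covered : Fin n → Set
    Covered v = ∃[ i ] InComp G b (D i) v

    Within : Path G → Set
    Within P = ∀ v → OnP G P v → Covered v

    within : ∀ i {u w} → Star (Arc (InComp G b (D i))) u w → Star (Arc Covered) u w
    within i = map λ (cu , a , cw) → (i , cu) , a , (i , cw)

    chain-reachable : ∀ {x} → InComp G b (D zero) x → ∀ i {y} → InComp G b (D i) y → Star (Arc Covered) x y
    chain-reachable {x} cx = <-weakInduction Q base step
      where
      Q : Fin (suc j) → Set
      Q i = ∀ {y} → InComp G b (D i) y → Star (Arc Covered) x y
      base : Q zero
      base cy = within zero (strongly-connected (D zero) (consistent zero) cx cy)
      step : ∀ i → Q (inject₁ i) → Q (suc i)
      step i reach cy with precA⇒arc (prec i)
      ... | inj₁ same = reach (same ◅◅ cy)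
      ... | inj₂ (u , w , cu , a , cw) =
        reach cu ◅◅ ((inject₁ i , cu) , a , (suc i , cw))
                 ◅ within (suc i) (strongly-connected (D (suc i)) (consistent (suc i)) cw cy)

    module Forward  = WalkPaths G {S = Arc Covered} (λ (_ , (f , joins , _) , _) → f , joins)
    module Backward = WalkPaths G {S = flip (Arc Covered)} (λ (_ , (f , joins , _) , _) → f , joins-sym joins)

    module ForwardInM = Forward.Alternating (inM M) inA (λ (_ , (_ , joins , colour) , _) →
      colour , trans colour (joins-colours joins))
    module BackwardNotInM = Backward.Alternating (not ∘ inM M) inA (λ (_ , (_ , joins , colour) , _) →
      trans (cong not colour) (sym (joins-colours (joins-sym joins))) , cong not colour)
    module BackwardInM = Backward.Alternating (inM M) (not ∘ inA) (λ (_ , (_ , joins , colour) , _) →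
      trans colour (joins-colours joins) , trans colour (sym (not-involutive _)))

    wedge-path : ∀ {x y} → Star (Arc Covered) x y → Covered x → InA G x → InA G y →
                 ∃[ P ] (Wedge G M P x y × Within P)
    wedge-path walk cx x∈A y∈A with Forward.simplePath (proj₂ ∘ proj₂) walk cx
    ... | p , fr , covered = Forward.toPath p fr , ForwardInM.toPath-wedge p fr x∈A y∈A , covered

    saturated-path : ∀ {x y} → Star (Arc Covered) x y → Covered x → InA G x → InB G y →
                     ∃[ P ] (Saturated G M P x y × Within P)
    saturated-path walk cx x∈A y∈B with Forward.simplePath (proj₂ ∘ proj₂) walk cx
    ... | p , fr , covered = Forward.toPath p fr , ForwardInM.toPath-saturated p fr x∈A y∈B , covered

    exposed-path : ∀ {x y} → Star (Arc Covered) y x → Covered x → InA G x → InB G y →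
                   ∃[ P ] (Exposed G M P x y × Within P)
    exposed-path walk cx x∈A y∈B with Backward.simplePath proj₁ (reverse id walk) cx
    ... | p , fr , covered = Backward.toPath p fr , BackwardNotInM.toPath-saturated p fr x∈A y∈B , covered

    reverse-wedge-path : ∀ {x y} → Star (Arc Covered) x y → Covered y → InB G x → InB G y →
                         ∃[ P ] (Wedge G M P y x × Within P)
    reverse-wedge-path walk cy x∈B y∈B with Backward.simplePath proj₁ (reverse id walk) cy
    ... | p , fr , covered =
      Backward.toPath p fr , BackwardInM.toPath-wedge p fr (cong not y∈B) (cong not x∈B) , covered

mainTheorem17 : (G : BGraph) (b : Fin (BGraph.n G) → ℕ)
    (c₁ c₂ : Fin (BGraph.n G)) → Consistent G b c₁ → Consistent G b c₂
    → (j : ℕ) (D : Fin (suc j) → Fin (BGraph.n G))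
    → (∀ i → Consistent G b (D i))
    → SameComp G b (D zero) c₁ → SameComp G b (D (fromℕ j)) c₂
    → (∀ (i : Fin j) → PrecA G b (D (inject₁ i)) (D (suc i)))
    → (M : Subset (BGraph.m G)) → IsMaxBMatching G b M
    → let Within : Path G → Set
          Within P = ∀ v → OnP G P v → ∃[ i ] InComp G b (D i) v
      in (∀ x y → InComp G b c₁ x → InA G x → InComp G b c₂ y → InA G y
            → ∃[ P ] (Wedge G M P x y × Within P))
       × (∀ x y → InComp G b c₁ x → InA G x → InComp G b c₂ y → InB G y
            → ∃[ P ] (Saturated G M P x y × Within P))
       × (∀ x y → InComp G b c₂ x → InA G x → InComp G b c₁ y → InB G y
            → ∃[ P ] (Exposed G M P x y × Within P))
       × (∀ x y → InComp G b c₁ x → InB G x → InComp G b c₂ y → InB G y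
            → ∃[ P ] (Wedge G M P y x × Within P))
-- c₁ and c₂ lie in the components D zero and D (fromℕ j), whose consistency is assumed anyway.
mainTheorem17 G b c₁ c₂ _ _ j D consistent D₀∋c₁ Dⱼ∋c₂ prec M mx =
    (λ x y x∈C₁ x∈A y∈C₂ y∈A → wedge-path (reach x∈C₁ y∈C₂) (zero , D₀∋c₁ ◅◅ x∈C₁) x∈A y∈A)
  , (λ x y x∈C₁ x∈A y∈C₂ y∈B → saturated-path (reach x∈C₁ y∈C₂) (zero , D₀∋c₁ ◅◅ x∈C₁) x∈A y∈B)
  , (λ x y x∈C₂ x∈A y∈C₁ y∈B → exposed-path (reach y∈C₁ x∈C₂) (fromℕ j , Dⱼ∋c₂ ◅◅ x∈C₂) x∈A y∈B)
  , (λ x y x∈C₁ x∈B y∈C₂ y∈B → reverse-wedge-path (reach x∈C₁ y∈C₂) (fromℕ j , Dⱼ∋c₂ ◅◅ y∈C₂) x∈B y∈B)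
  where
  open Components.Chain G b M mx j D consistent prec
  open Bipartite.Oriented G M using (Arc)
  reach : ∀ {x y} → InComp G b c₁ x → InComp G b c₂ y → Star (Arc Covered) x y
  reach x∈C₁ y∈C₂ = chain-reachable (D₀∋c₁ ◅◅ x∈C₁) (fromℕ j) (Dⱼ∋c₂ ◅◅ y∈C₂)
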